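{- If $(K,v)$ is an extremal valued field and $v=w\circ\overline{w}$, then $(Kw,\overline{w})$ is extremal.
   Context: $v=w\circ\overline{w}$ means: $w$ is a valuation on $K$ whose valuation ring ${\cal O}_w$ contains the valuation ring ${\cal O}_v$ of $v$, $Kw$ is the residue field of $w$, and $\overline{w}$ is the valuation on $Kw$ induced by $v$ (its valuation ring is the image of ${\cal O}_v$ in $Kw$). A valued field $(K,v)$ with valuation ring ${\cal O}$ is extremal if for every $n\ge1$ and every polynomial $f(X_1,\dots,X_n)$ over $K$ the set $\{v(f(a_1,\dots,a_n))\mid a_1,\dots,a_n\in{\cal O}\}$ has a maximal element. -}

module Defs where

open import Level using (Level; _⊔_)
open import Data.Nat using (ℕ)
open import Data.Fin using (Fin)
open import Data.Product using (Σ; ∃; _×_; _,_; proj₁; proj₂)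
open import Data.Sum using (_⊎_)
open import Relation.Nullary using (¬_)
open import Algebra.Bundles using (CommutativeRing)

IsField : ∀ {c ℓ} → CommutativeRing c ℓ → Set (c ⊔ ℓ)
IsField R = (¬ (1# ≈ 0#)) × (∀ x → ¬ (x ≈ 0#) → ∃ λ y → x * y ≈ 1#)
  where open CommutativeRing R

record IsValuationRing {c ℓ p} (K : CommutativeRing c ℓ)
                       (O : CommutativeRing.Carrier K → Set p) : Set (c ⊔ ℓ ⊔ p) where
  open CommutativeRing K
  field
    resp  : ∀ {x y} → x ≈ y → O x → O y
    has0  : O 0#
    has1  : O 1#
    +-cl  : ∀ {x y} → O x → O y → O (x + y)
    *-cl  : ∀ {x y} → O x → O y → O (x * y)
    neg-cl : ∀ {x} → O x → O (- x)
    total : ∀ x → ¬ (x ≈ 0#) → O x ⊎ (∃ λ y → (x * y ≈ 1#) × O y)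

-- The valuation v is the one determined by O:  v(x) ≤ v(y)  iff  y ∈ x·O.
record RawValued (c ℓ p : Level) : Set (Level.suc (c ⊔ ℓ ⊔ p)) where
  field
    Carrier : Set c
    _≈_     : Carrier → Carrier → Set ℓ
    _+_ _*_ : Carrier → Carrier → Carrier
    -_      : Carrier → Carrier
    0# 1#   : Carrier
    O       : Carrier → Set p

  _≼_ : Carrier → Carrier → Set (c ⊔ ℓ ⊔ p)
  x ≼ y = ∃ λ z → O z × (y ≈ (z * x))

data Poly {a} (A : Set a) (n : ℕ) : Set a where
  con  : A → Poly A n
  var  : Fin n → Poly A n
  _⊕_  : Poly A n → Poly A n → Poly A n
  _⊗_  : Poly A n → Poly A n → Poly A n
  ⊝_   : Poly A n → Poly A n

module _ {c ℓ p} (R : RawValued c ℓ p) where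
  open RawValued R

  eval : ∀ {n} → Poly Carrier n → (Fin n → Carrier) → Carrier
  eval (con a) ρ = a
  eval (var i) ρ = ρ i
  eval (f ⊕ g) ρ = eval f ρ + eval g ρ
  eval (f ⊗ g) ρ = eval f ρ * eval g ρ
  eval (⊝ f) ρ = - eval f ρ

  Extremal : Set (c ⊔ ℓ ⊔ p)
  Extremal = ∀ (n : ℕ) → 1 Data.Nat.≤ n → (f : Poly Carrier n) →
    Σ (Fin n → Carrier) λ a → (∀ i → O (a i)) ×
      (∀ (b : Fin n → Carrier) → (∀ i → O (b i)) → eval f b ≼ eval f a)

valued : ∀ {c ℓ p} (K : CommutativeRing c ℓ) → (CommutativeRing.Carrier K → Set p) → RawValued c ℓ p
valued K Ov = record
  { Carrier = Carrier ; _≈_ = _≈_ ; _+_ = _+_ ; _*_ = _*_ ; -_ = -_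
  ; 0# = 0# ; 1# = 1# ; O = Ov }
  where open CommutativeRing K

module Residue {c ℓ p} (K : CommutativeRing c ℓ)
               (Ow : CommutativeRing.Carrier K → Set p) (isOw : IsValuationRing K Ow)
               (Ov : CommutativeRing.Carrier K → Set p) where
  open CommutativeRing K
  open IsValuationRing isOw

  mw : Carrier → Set (c ⊔ ℓ ⊔ p)
  mw x = Ow x × (¬ (∃ λ y → Ow y × (x * y ≈ 1#)))

  -- Kw = Ow / mw, as a setoid on Ow
  Kw : Set (c ⊔ p)
  Kw = Σ Carrier Ow

  _≈w_ : Kw → Kw → Set (c ⊔ ℓ ⊔ p)
  x ≈w y = mw (proj₁ x - proj₁ y)

  Owbar : Kw → Set (c ⊔ ℓ ⊔ p)
  Owbar x = ∃ λ y → Ov y × mw (proj₁ x - y)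

  residueValued : RawValued (c ⊔ p) (c ⊔ ℓ ⊔ p) (c ⊔ ℓ ⊔ p)
  residueValued = record
    { Carrier = Kw ; _≈_ = _≈w_
    ; _+_ = λ x y → (proj₁ x + proj₁ y , +-cl (proj₂ x) (proj₂ y))
    ; _*_ = λ x y → (proj₁ x * proj₁ y , *-cl (proj₂ x) (proj₂ y))
    ; -_ = λ x → (- proj₁ x , neg-cl (proj₂ x))
    ; 0# = (0# , has0) ; 1# = (1# , has1)
    ; O = Owbar }

module Submission where

-- Let v = w ∘ w̄ on the field K, i.e. O_v ⊆ O_w, and let 𝔪 be the maximal ideal
-- of O_w, so that Kw = O_w / 𝔪 and w̄ has valuation ring Ō_v = (O_v + 𝔪) / 𝔪.
-- Extremality descends along the residue map: given a polynomial f over Kw,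
-- lift its coefficients to representatives in O_w, obtaining F over K with
-- F(a) ↦ f(ā).  By extremality of (K,v) some a ∈ O_vⁿ maximises v(F(·)) on
-- O_vⁿ.  Every b ∈ Ō_vⁿ is the residue of some y ∈ O_vⁿ, and F(a) = z·F(y) with
-- z ∈ O_v reduces to f(ā) = z̄·f(b) with z̄ ∈ Ō_v; hence ā maximises w̄(f(·)).

open import Defs
open import Level using (_⊔_)
open import Algebra.Bundles using (CommutativeRing)
open import Data.Fin using (Fin)
open import Data.Nat using (ℕ)
open import Data.Product using (Σ; ∃; _×_; _,_; proj₁; proj₂)
open import Data.Sum using (_⊎_; inj₁; inj₂)
open import Relation.Nullary using (¬_)
import Relation.Binary.PropositionalEquality as P
import Relation.Binary.Reasoning.Setoid as SetoidReasoning
import Algebra.Properties.Ring as RingProperties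
import Algebra.Properties.AbelianGroup as AbelianGroupProperties
import Algebra.Properties.CommutativeSemigroup as CommutativeSemigroupProperties

Maximiser : ∀ {c ℓ p} (R : RawValued c ℓ p) {n : ℕ} → Poly (RawValued.Carrier R) n →
  Set (c ⊔ ℓ ⊔ p)
Maximiser R {n} f = Σ (Fin n → Carrier) λ a → (∀ i → O (a i)) ×
  (∀ (b : Fin n → Carrier) → (∀ i → O (b i)) → eval R f b ≼ eval R f a)
  where open RawValued R

module ValuationRingOfField {c ℓ p} (K : CommutativeRing c ℓ) (isField : IsField K)
  (O : CommutativeRing.Carrier K → Set p) (isO : IsValuationRing K O) where
  open CommutativeRing K
  open IsValuationRing isO
  open SetoidReasoning setoid
  open RingProperties ring using (-1*x≈-x; -‿distribʳ-*)
  open AbelianGroupProperties +-abelianGroup using (⁻¹-anti-homo‿-; ⁻¹-∙-comm; x≈y⇒x∙y⁻¹≈ε)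
  open CommutativeSemigroupProperties *-commutativeSemigroup using (x∙yz≈xz∙y; xy∙z≈y∙xz)
  open RawValued (valued K O) using (_≼_)

  Unit : Carrier → Set (c ⊔ ℓ ⊔ p)
  Unit x = ∃ λ u → O u × (x * u ≈ 1#)

  -- The maximal ideal 𝔪 of O; `Residue.mw` unfolds to exactly this predicate.
  NonUnit : Carrier → Set (c ⊔ ℓ ⊔ p)
  NonUnit x = O x × ¬ Unit x

  unit-resp : ∀ {x y} → x ≈ y → Unit x → Unit y
  unit-resp x≈y (u , Ou , xu≈1) = u , Ou , trans (*-cong (sym x≈y) refl) xu≈1

  nonUnit-resp : ∀ {x y} → x ≈ y → NonUnit x → NonUnit y
  nonUnit-resp x≈y (Ox , ¬ux) = resp x≈y Ox , λ uy → ¬ux (unit-resp (sym x≈y) uy)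

  nonUnit-0 : NonUnit 0#
  nonUnit-0 = has0 , λ { (u , _ , 0u≈1) → proj₁ isField (trans (sym 0u≈1) (zeroˡ u)) }

  unit-of-factor : ∀ {x z w} → O w → z ≈ x * w → Unit z → Unit x
  unit-of-factor {x} {z} {w} Ow z≈xw (u , Ou , zu≈1) = w * u , *-cl Ow Ou , (begin
    x * (w * u) ≈⟨ *-assoc x w u ⟨
    (x * w) * u ≈⟨ *-cong z≈xw refl ⟨
    z * u       ≈⟨ zu≈1 ⟩
    1#          ∎)

  nonUnit-* : ∀ {a x} → O a → NonUnit x → NonUnit (a * x)
  nonUnit-* {a} {x} Oa (Ox , ¬ux) =
    *-cl Oa Ox , λ uax → ¬ux (unit-of-factor Oa (*-comm a x) uax)

  nonUnit-neg : ∀ {x} → NonUnit x → NonUnit (- x)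
  nonUnit-neg {x} nx = nonUnit-resp (-1*x≈-x x) (nonUnit-* (neg-cl has1) nx)

  ≼-zero : ∀ {x y} → x ≈ 0# → y ≼ x
  ≼-zero {y = y} x≈0 = 0# , has0 , trans x≈0 (sym (zeroˡ y))

  through-inverse : ∀ x {y y⁻¹} → y * y⁻¹ ≈ 1# → x ≈ (x * y⁻¹) * y
  through-inverse x {y} {y⁻¹} yy⁻¹≈1 = begin
    x               ≈⟨ *-identityʳ x ⟨
    x * 1#          ≈⟨ *-cong refl yy⁻¹≈1 ⟨
    x * (y * y⁻¹)   ≈⟨ x∙yz≈xz∙y x y y⁻¹ ⟩
    (x * y⁻¹) * y   ∎

  -- Divisibility in O is total between nonzero elements: x·y⁻¹ ∈ O gives y ≼ x,
  -- and (x·y⁻¹)⁻¹ ∈ O gives x ≼ y.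
  ≼-total-nonzero : ∀ {x y} → ¬ (x ≈ 0#) → ¬ (y ≈ 0#) → x ≼ y ⊎ y ≼ x
  ≼-total-nonzero {x} {y} x≉0 y≉0 = compare (proj₂ isField y y≉0)
    where
    compare : (∃ λ y⁻¹ → y * y⁻¹ ≈ 1#) → x ≼ y ⊎ y ≼ x
    compare (y⁻¹ , yy⁻¹≈1) = by-cases (total (x * y⁻¹) q≉0)
      where
      x≈qy : x ≈ (x * y⁻¹) * y
      x≈qy = through-inverse x yy⁻¹≈1
      q≉0 : ¬ (x * y⁻¹ ≈ 0#)
      q≉0 q≈0 = x≉0 (trans x≈qy (trans (*-cong q≈0 refl) (zeroˡ y)))
      by-cases : O (x * y⁻¹) ⊎ (∃ λ t → (x * y⁻¹ * t ≈ 1#) × O t) → x ≼ y ⊎ y ≼ x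
      by-cases (inj₁ Oq) = inj₂ (x * y⁻¹ , Oq , x≈qy)
      by-cases (inj₂ (t , qt≈1 , Ot)) = inj₁ (t , Ot , (begin
        y                     ≈⟨ *-identityˡ y ⟨
        1# * y                ≈⟨ *-cong qt≈1 refl ⟨
        ((x * y⁻¹) * t) * y   ≈⟨ xy∙z≈y∙xz (x * y⁻¹) t y ⟩
        t * ((x * y⁻¹) * y)   ≈⟨ *-cong refl x≈qy ⟨
        t * x                 ∎))

  -- Totality of divisibility, in the double-negated form available constructively
  -- (whether an element is 0 is not decidable).
  ≼-total : ∀ x y → ¬ ¬ (x ≼ y ⊎ y ≼ x)
  ≼-total x y ¬comparable = ¬comparable (≼-total-nonzero x≉0 y≉0)
    where
    x≉0 : ¬ (x ≈ 0#)
    x≉0 x≈0 = ¬comparable (inj₂ (≼-zero x≈0))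
    y≉0 : ¬ (y ≈ 0#)
    y≉0 y≈0 = ¬comparable (inj₁ (≼-zero y≈0))

  -- If x divides y then x + y = x·(1 + t) is a multiple of x.
  unit-of-sum : ∀ {x y} → x ≼ y → Unit (x + y) → Unit x
  unit-of-sum {x} {y} (t , Ot , y≈tx) = unit-of-factor (+-cl has1 Ot) (begin
    x + y             ≈⟨ +-cong (*-identityʳ x) (trans (*-comm x t) (sym y≈tx)) ⟨
    x * 1# + x * t    ≈⟨ distribˡ x 1# t ⟨
    x * (1# + t)      ∎)

  -- 𝔪 is closed under addition: if x ≼ y and x + y were a unit, so would be x.
  nonUnit-+ : ∀ {x y} → NonUnit x → NonUnit y → NonUnit (x + y)
  nonUnit-+ {x} {y} (Ox , ¬ux) (Oy , ¬uy) = +-cl Ox Oy , λ uxy → ≼-total x y λ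
    { (inj₁ x≼y) → ¬ux (unit-of-sum x≼y uxy)
    ; (inj₂ y≼x) → ¬uy (unit-of-sum y≼x (unit-resp (+-comm x y) uxy)) }

  -- Congruence modulo 𝔪; on representatives it is the equality of the residue field.
  _∼_ : Carrier → Carrier → Set (c ⊔ ℓ ⊔ p)
  x ∼ y = NonUnit (x - y)

  ∼-reflexive : ∀ {x y} → x ≈ y → x ∼ y
  ∼-reflexive x≈y = nonUnit-resp (sym (x≈y⇒x∙y⁻¹≈ε x≈y)) nonUnit-0

  ∼-sym : ∀ {x y} → x ∼ y → y ∼ x
  ∼-sym {x} {y} x∼y = nonUnit-resp (⁻¹-anti-homo‿- x y) (nonUnit-neg x∼y)

  ∼-trans : ∀ {x y z} → x ∼ y → y ∼ z → x ∼ z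
  ∼-trans {x} {y} {z} x∼y y∼z = nonUnit-resp telescope (nonUnit-+ x∼y y∼z)
    where
    telescope : (x - y) + (y - z) ≈ x - z
    telescope = begin
      (x - y) + (y - z)     ≈⟨ +-assoc x (- y) (y - z) ⟩
      x + (- y + (y - z))   ≈⟨ +-cong refl (+-assoc (- y) y (- z)) ⟨
      x + ((- y + y) - z)   ≈⟨ +-cong refl (+-cong (-‿inverseˡ y) refl) ⟩
      x + (0# - z)          ≈⟨ +-cong refl (+-identityˡ (- z)) ⟩
      x - z                 ∎

  +-cong-∼ : ∀ {x x' y y'} → x ∼ x' → y ∼ y' → (x + y) ∼ (x' + y')
  +-cong-∼ {x} {x'} {y} {y'} x∼x' y∼y' = nonUnit-resp regroup (nonUnit-+ x∼x' y∼y')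
    where
    open CommutativeSemigroupProperties +-commutativeSemigroup using (interchange)
    regroup : (x - x') + (y - y') ≈ (x + y) - (x' + y')
    regroup = trans (interchange x (- x') y (- y')) (+-cong refl (⁻¹-∙-comm x' y'))

  neg-cong-∼ : ∀ {x x'} → x ∼ x' → (- x) ∼ (- x')
  neg-cong-∼ {x} {x'} x∼x' = nonUnit-resp (sym (⁻¹-∙-comm x (- x'))) (nonUnit-neg x∼x')

  -- Multiplication is compatible with ∼ on O:  xy − x'y' = x(y − y') + y'(x − x').
  *-cong-∼ : ∀ {x x' y y'} → O x → O y' → x ∼ x' → y ∼ y' → (x * y) ∼ (x' * y')
  *-cong-∼ {x} {x'} {y} {y'} Ox Oy' x∼x' y∼y' =
    nonUnit-resp expand (nonUnit-+ (nonUnit-* Ox y∼y') (nonUnit-* Oy' x∼x'))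
    where
    cancel : x * - y' + y' * x ≈ 0#
    cancel = begin
      x * - y' + y' * x     ≈⟨ +-cong (-‿distribʳ-* x y') (*-comm x y') ⟨
      - (x * y') + x * y'   ≈⟨ -‿inverseˡ (x * y') ⟩
      0#                    ∎
    expand : x * (y - y') + y' * (x - x') ≈ (x * y) - (x' * y')
    expand = begin
      x * (y - y') + y' * (x - x')              ≈⟨ +-cong (distribˡ x y (- y')) (distribˡ y' x (- x')) ⟩
      (x * y + x * - y') + (y' * x + y' * - x') ≈⟨ +-assoc (x * y) (x * - y') _ ⟩
      x * y + (x * - y' + (y' * x + y' * - x')) ≈⟨ +-cong refl (+-assoc (x * - y') (y' * x) _) ⟨
      x * y + ((x * - y' + y' * x) + y' * - x') ≈⟨ +-cong refl (+-cong cancel refl) ⟩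
      x * y + (0# + y' * - x')                  ≈⟨ +-cong refl (+-identityˡ _) ⟩
      x * y + y' * - x'                         ≈⟨ +-cong refl (-‿distribʳ-* y' x') ⟨
      x * y - (y' * x')                         ≈⟨ +-cong refl (-‿cong (*-comm y' x')) ⟩
      (x * y) - (x' * y')                       ∎

module ResidueField {c ℓ p} (K : CommutativeRing c ℓ) (isField : IsField K)
  (Ow : CommutativeRing.Carrier K → Set p) (isOw : IsValuationRing K Ow)
  (Ov : CommutativeRing.Carrier K → Set p) where
  open CommutativeRing K
  open Residue K Ow isOw Ov
  open ValuationRingOfField K isField Ow isOw
  open RawValued residueValued using () renaming (_≼_ to _≼w_)
  open SetoidReasoning setoid

  evalw : ∀ {n} → Poly Kw n → (Fin n → Kw) → Kw
  evalw = eval residueValued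

  eval-cong : ∀ {n} (f : Poly Kw n) {ρ σ : Fin n → Kw} →
    (∀ i → ρ i ≈w σ i) → evalw f ρ ≈w evalw f σ
  eval-cong (con a) _ = ∼-reflexive refl
  eval-cong (var i) ρ∼σ = ρ∼σ i
  eval-cong (f ⊕ g) ρ∼σ = +-cong-∼ (eval-cong f ρ∼σ) (eval-cong g ρ∼σ)
  eval-cong (f ⊗ g) {ρ} {σ} ρ∼σ =
    *-cong-∼ (proj₂ (evalw f ρ)) (proj₂ (evalw g σ)) (eval-cong f ρ∼σ) (eval-cong g ρ∼σ)
  eval-cong (⊝ f) ρ∼σ = neg-cong-∼ (eval-cong f ρ∼σ)

  lift : ∀ {n} → Poly Kw n → Poly Carrier n
  lift (con a) = con (proj₁ a)
  lift (var i) = var i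
  lift (f ⊕ g) = lift f ⊕ lift g
  lift (f ⊗ g) = lift f ⊗ lift g
  lift (⊝ f)   = ⊝ lift f

  eval-lift : ∀ {n} (f : Poly Kw n) (ρ : Fin n → Kw) →
    proj₁ (evalw f ρ) P.≡ eval (valued K Ov) (lift f) (λ i → proj₁ (ρ i))
  eval-lift (con a) ρ = P.refl
  eval-lift (var i) ρ = P.refl
  eval-lift (f ⊕ g) ρ = P.cong₂ _+_ (eval-lift f ρ) (eval-lift g ρ)
  eval-lift (f ⊗ g) ρ = P.cong₂ _*_ (eval-lift f ρ) (eval-lift g ρ)
  eval-lift (⊝ f) ρ   = P.cong -_ (eval-lift f ρ)

  residue-in-Ōv : ∀ {y} → Ov y → (Owy : Ow y) → Owbar (y , Owy)
  residue-in-Ōv {y} Ovy _ = y , Ovy , ∼-reflexive refl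

  ≼w-from-representatives : ∀ {a b : Kw} {z} → Ov z → (Owz : Ow z) →
    proj₁ a ≈ z * proj₁ b → b ≼w a
  ≼w-from-representatives Ovz Owz a≈zb = (_ , Owz) , residue-in-Ōv Ovz Owz , ∼-reflexive a≈zb

  ≼w-respˡ : ∀ {a a' b : Kw} → a ≈w a' → a ≼w b → a' ≼w b
  ≼w-respˡ {a} {a'} a≈a' (z , Ōz , b≈za) =
    z , Ōz , ∼-trans b≈za (*-cong-∼ (proj₂ z) (proj₂ a') (∼-reflexive refl) a≈a')

  residue-maximiser : (∀ x → Ov x → Ow x) → ∀ {n} (f : Poly Kw n) →
    Maximiser (valued K Ov) (lift f) → Maximiser residueValued f
  residue-maximiser Ov⊆Ow {n} f (a , a∈Ov , a-maximal) = ā , ā∈Ōv , ā-maximal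
    where
    residue : ∀ {x} → Ov x → Kw
    residue {x} Ovx = x , Ov⊆Ow x Ovx

    ā : Fin n → Kw
    ā i = residue (a∈Ov i)

    ā∈Ōv : ∀ i → Owbar (ā i)
    ā∈Ōv i = residue-in-Ōv (a∈Ov i) (proj₂ (ā i))

    ā-maximal : ∀ b → (∀ i → Owbar (b i)) → evalw f b ≼w evalw f ā
    ā-maximal b b∈Ōv with a-maximal (λ i → proj₁ (b∈Ōv i)) (λ i → proj₁ (proj₂ (b∈Ōv i)))
    ... | z , Ovz , Fa≈zFy =
      ≼w-respˡ {evalw f ȳ} {evalw f b} {evalw f ā} (eval-cong f ȳ≈b)
        (≼w-from-representatives {evalw f ā} {evalw f ȳ} Ovz (Ov⊆Ow z Ovz) fā≈zfȳ)
      where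
      ȳ : Fin n → Kw
      ȳ i = residue (proj₁ (proj₂ (b∈Ōv i)))
      ȳ≈b : ∀ i → ȳ i ≈w b i
      ȳ≈b i = ∼-sym (proj₂ (proj₂ (b∈Ōv i)))
      fā≈zfȳ : proj₁ (evalw f ā) ≈ z * proj₁ (evalw f ȳ)
      fā≈zfȳ = begin
        proj₁ (evalw f ā)                   ≡⟨ eval-lift f ā ⟩
        eval (valued K Ov) (lift f) _       ≈⟨ Fa≈zFy ⟩
        z * eval (valued K Ov) (lift f) _   ≡⟨ P.cong (z *_) (eval-lift f ȳ) ⟨
        z * proj₁ (evalw f ȳ)               ∎

lemma4p1 : ∀ {c ℓ p} (K : CommutativeRing c ℓ) → IsField K →
    (Ov Ow : CommutativeRing.Carrier K → Set p) →
    IsValuationRing K Ov → (isOw : IsValuationRing K Ow) →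
    (∀ x → Ov x → Ow x) →
    Extremal (valued K Ov) →
    Extremal (Residue.residueValued K Ow isOw Ov)
lemma4p1 K isField Ov Ow _ isOw Ov⊆Ow extremal n 1≤n f =
  residue-maximiser Ov⊆Ow f (extremal n 1≤n (lift f))
  where open ResidueField K isField Ow isOw Ov
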